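{- Every $(k,q,a,d)$-blurer $\Xi$ has odd size $|\Xi|$.
   Context: For $\Xi\subseteq\mathbb{Z}_{2^q}^d$, $N\subseteq[d]$, $\bar b\in\mathbb{Z}_{2^q}^{|N|}$ let $\#_{N,\bar b}(\Xi)=|\{\bar c\in\Xi:\bar c|_N=\bar b\}|\bmod2$, where $\bar c|_N$ is the restriction to indices in $N$ (in increasing order). For $d\ge k$ and $a\in\mathbb{Z}_{2^q}$, $\Xi$ is a $(k,q,a,d)$-blurer if for all $N\subseteq[d]$ with $|N|=k$: (1) $\sum_j\xi(j)=0$ for all $\xi\in\Xi$; (2) if $1\in N$ then $\#_{N,(a,0,\dots,0)}(\Xi)=1$; (3) if $1\notin N$ then $\#_{N,\bar0}(\Xi)=1$; (4) $\#_{N,\bar b}(\Xi)=0$ for all other pairs $N,\bar b$. -}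

module Defs where

open import Data.Nat using (ℕ; zero; suc; _+_; _∸_; _^_; _%_; _≤_)
open import Data.Nat.Divisibility using (_∣_)
open import Data.Nat.Properties using () renaming (_≟_ to _≟ℕ_)
open import Data.Bool using (Bool; true; false; if_then_else_)
open import Data.Fin using (Fin; toℕ)
open import Data.Fin.Subset using (Subset; ∣_∣)
open import Data.Vec using (Vec; []; _∷_; toList)
open import Data.List using (List; []; _∷_; length; filter; map; replicate)
open import Data.Nat.ListAction using (sum)
open import Data.List.Properties using (≡-dec)
open import Data.List.Relation.Unary.Unique.Propositional using (Unique)
open import Data.Product using (_×_)
open import Relation.Binary.PropositionalEquality using (_≡_)
open import Relation.Nullary using (¬_)

Zmod : ℕ → Set
Zmod q = Fin (2 ^ q)

restrict : ∀ q {d} → Subset d → Vec (Zmod q) d → List ℕ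
restrict q []            []       = []
restrict q (true  ∷ N) (x ∷ ξ) = toℕ x ∷ restrict q N ξ
restrict q (false ∷ N) (x ∷ ξ) = restrict q N ξ

oneIn : ∀ {d} → Subset d → Bool
oneIn []      = false
oneIn (s ∷ _) = s

count# : ∀ q {d k} → List (Vec (Zmod q) d) → Subset d → Vec (Zmod q) k → ℕ
count# q Ξ N b =
  length (filter (λ c → ≡-dec _≟ℕ_ (restrict q N c) (map toℕ (toList b))) Ξ) % 2

target : ∀ q → ℕ → Zmod q → Bool → List ℕ
target q k a true  = toℕ a ∷ replicate (k ∸ 1) 0
target q k a false = replicate k 0

-- (k,q,a,d)-blurer, where Ξ ⊆ ℤ_{2^q}^d is given as a duplicate-free list.
IsBlurer : (k q : ℕ) → Zmod q → (d : ℕ) → List (Vec (Zmod q) d) → Set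
IsBlurer k q a d Ξ =
  k ≤ d ×
  Unique Ξ ×
  (∀ ξ → ξ Data.List.Membership.Propositional.∈ Ξ → (2 ^ q) ∣ sum (map toℕ (toList ξ))) ×
  (∀ (N : Subset d) → ∣ N ∣ ≡ k → ∀ (b : Vec (Zmod q) k) →
     (map toℕ (toList b) ≡ target q k a (oneIn N) → count# q Ξ N b ≡ 1) ×
     (¬ (map toℕ (toList b) ≡ target q k a (oneIn N)) → count# q Ξ N b ≡ 0))
  where import Data.List.Membership.Propositional

{-# OPTIONS --safe #-}
module Submission where

-- Fix any N of size k, say the first k coordinates, and split Ξ into the
-- classes of vectors with the same restriction to N.  By (4) every class
-- other than that of the distinguished pattern has even size, and by (2)/(3)
-- that one has odd size; hence |Ξ|, the sum of the class sizes, is odd.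

open import Defs
open import Data.Nat using (ℕ; zero; suc; _+_; _%_; _≤_; _<_; z≤n; s≤s; s≤s⁻¹)
open import Data.Nat.Properties using (+-suc; +-identityʳ; ≤-refl; <-≤-trans) renaming (_≟_ to _≟ℕ_)
open import Data.Nat.DivMod using (%-distribˡ-+; m%n%n≡m%n)
open import Data.Bool using (true; false)
open import Data.Fin using (Fin; toℕ; fromℕ<)
open import Data.Fin.Properties using (toℕ-fromℕ<; toℕ<n)
open import Data.Fin.Subset using (Subset; ∣_∣) renaming (⊥ to ∅)
open import Data.Fin.Subset.Properties using (∣⊥∣≡0)
open import Data.Vec using (Vec; []; _∷_; toList; cast)
import Data.Vec as Vec
open import Data.Vec.Properties using (toList-cast; toList-replicate)
open import Data.List using (List; []; _∷_; length; filter; map; replicate)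
open import Data.List.Properties using (≡-dec; filter-notAll; map-replicate)
open import Data.List.Membership.Propositional using (_∈_)
open import Data.List.Membership.Propositional.Properties using (∈-filter⁻)
open import Data.List.Relation.Unary.Any using (here)
import Data.List.Relation.Unary.Any as Any
open import Data.Product using (_,_; proj₁; proj₂)
open import Data.Empty using (⊥-elim)
open import Relation.Binary.Definitions using (DecidableEquality)
open import Relation.Binary.PropositionalEquality using (_≡_; refl; sym; trans; cong; cong₂; module ≡-Reasoning)
open import Relation.Nullary using (¬_; yes; no; ¬?)

module FibreParity {A B : Set} (_≟_ : DecidableEquality A) (f : B → A) where

  fibreSize : A → List B → ℕ
  fibreSize v xs = length (filter (λ c → f c ≟ v) xs)

  outsideFibre : A → List B → List B
  outsideFibre v = filter (λ c → ¬? (f c ≟ v))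

  length≡fibreSize+outsideFibre : ∀ v xs → length xs ≡ fibreSize v xs + length (outsideFibre v xs)
  length≡fibreSize+outsideFibre v []       = refl
  length≡fibreSize+outsideFibre v (x ∷ xs) with f x ≟ v
  ... | yes _ = cong suc (length≡fibreSize+outsideFibre v xs)
  ... | no  _ = trans (cong suc (length≡fibreSize+outsideFibre v xs)) (sym (+-suc _ _))

  fibreSize-outsideFibre : ∀ {v w} → ¬ w ≡ v → ∀ xs → fibreSize w (outsideFibre v xs) ≡ fibreSize w xs
  fibreSize-outsideFibre w≢v []       = refl
  fibreSize-outsideFibre {v} {w} w≢v (x ∷ xs) with f x ≟ v
  ... | yes fx≡v with f x ≟ w
  ...   | yes fx≡w = ⊥-elim (w≢v (trans (sym fx≡w) fx≡v))
  ...   | no  _    = fibreSize-outsideFibre w≢v xs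
  fibreSize-outsideFibre {v} {w} w≢v (x ∷ xs) | no _ with f x ≟ w
  ...   | yes _ = cong suc (fibreSize-outsideFibre w≢v xs)
  ...   | no  _ = fibreSize-outsideFibre w≢v xs

  length-outsideFibre-< : ∀ {y} ys → y ∈ ys → length (outsideFibre (f y) ys) < length ys
  length-outsideFibre-< ys y∈ys =
    filter-notAll (λ c → ¬? (f c ≟ _)) ys (Any.map (λ { refl fy≢fy → fy≢fy refl }) y∈ys)

  EvenFibres : List B → Set
  EvenFibres xs = ∀ c → c ∈ xs → fibreSize (f c) xs % 2 ≡ 0

  evenFibres-outsideFibre : ∀ v xs → (∀ c → c ∈ xs → ¬ f c ≡ v → fibreSize (f c) xs % 2 ≡ 0) →
                            EvenFibres (outsideFibre v xs)
  evenFibres-outsideFibre v xs even c c∈out with ∈-filter⁻ (λ c → ¬? (f c ≟ v)) {xs = xs} c∈out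
  ... | c∈xs , fc≢v = trans (cong (_% 2) (fibreSize-outsideFibre fc≢v xs)) (even c c∈xs fc≢v)

  length-even : ∀ xs → EvenFibres xs → length xs % 2 ≡ 0
  length-even xs = bounded (length xs) xs ≤-refl
    where
    open ≡-Reasoning
    bounded : ∀ n xs → length xs ≤ n → EvenFibres xs → length xs % 2 ≡ 0
    bounded _       []       _      _    = refl
    bounded (suc n) (y ∷ ys) |xs|≤n even = begin
      length (y ∷ ys) % 2                                   ≡⟨ cong (_% 2) (length≡fibreSize+outsideFibre (f y) (y ∷ ys)) ⟩
      (fibreSize (f y) (y ∷ ys) + length rest) % 2          ≡⟨ %-distribˡ-+ (fibreSize (f y) (y ∷ ys)) (length rest) 2 ⟩
      (fibreSize (f y) (y ∷ ys) % 2 + length rest % 2) % 2  ≡⟨ cong₂ (λ m n → (m + n) % 2) (even y (here refl)) rest-even ⟩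
      0                                                     ∎
      where
      rest : List B
      rest = outsideFibre (f y) (y ∷ ys)
      rest-even : length rest % 2 ≡ 0
      rest-even = bounded n rest (s≤s⁻¹ (<-≤-trans (length-outsideFibre-< (y ∷ ys) (here refl)) |xs|≤n))
                    (evenFibres-outsideFibre (f y) (y ∷ ys) (λ c c∈xs _ → even c c∈xs))

  length%2≡fibreSize%2 : ∀ t xs → (∀ c → c ∈ xs → ¬ f c ≡ t → fibreSize (f c) xs % 2 ≡ 0) →
                         length xs % 2 ≡ fibreSize t xs % 2
  length%2≡fibreSize%2 t xs even = begin
    length xs % 2                                   ≡⟨ cong (_% 2) (length≡fibreSize+outsideFibre t xs) ⟩
    (fibreSize t xs + length rest) % 2              ≡⟨ %-distribˡ-+ (fibreSize t xs) (length rest) 2 ⟩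
    (fibreSize t xs % 2 + length rest % 2) % 2      ≡⟨ cong (λ n → (fibreSize t xs % 2 + n) % 2) rest-even ⟩
    (fibreSize t xs % 2 + 0) % 2                    ≡⟨ cong (_% 2) (+-identityʳ (fibreSize t xs % 2)) ⟩
    fibreSize t xs % 2 % 2                          ≡⟨ m%n%n≡m%n (fibreSize t xs) 2 ⟩
    fibreSize t xs % 2                              ∎
    where
    open ≡-Reasoning
    rest : List B
    rest = outsideFibre t xs
    rest-even : length rest % 2 ≡ 0
    rest-even = length-even rest (evenFibres-outsideFibre t xs even)

firstCoordinates : ∀ {k d} → k ≤ d → Subset d
firstCoordinates z≤n     = ∅
firstCoordinates (s≤s p) = true ∷ firstCoordinates p

∣firstCoordinates∣ : ∀ {k d} (p : k ≤ d) → ∣ firstCoordinates p ∣ ≡ k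
∣firstCoordinates∣ {d = d} z≤n = ∣⊥∣≡0 d
∣firstCoordinates∣ (s≤s p)     = cong suc (∣firstCoordinates∣ p)

restrictVec : ∀ q {d} (N : Subset d) → Vec (Zmod q) d → Vec (Zmod q) ∣ N ∣
restrictVec q []          []      = []
restrictVec q (true  ∷ N) (x ∷ c) = x ∷ restrictVec q N c
restrictVec q (false ∷ N) (x ∷ c) = restrictVec q N c

toℕ-restrictVec : ∀ q {d} (N : Subset d) (c : Vec (Zmod q) d) →
                  map toℕ (toList (restrictVec q N c)) ≡ restrict q N c
toℕ-restrictVec q []          []      = refl
toℕ-restrictVec q (true  ∷ N) (x ∷ c) = cong (toℕ x ∷_) (toℕ-restrictVec q N c)
toℕ-restrictVec q (false ∷ N) (x ∷ c) = toℕ-restrictVec q N c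

-- ℤ_{2^q} has no syntactic zero (2 ^ q is not of the form suc _); any element witnesses 2 ^ q > 0.
zeroLike : ∀ {n} → Fin n → Fin n
zeroLike x = fromℕ< (<-≤-trans (s≤s z≤n) (toℕ<n x))

targetVec : ∀ q k → Zmod q → Vec (Zmod q) k
targetVec q zero    a = []
targetVec q (suc k) a = a ∷ Vec.replicate k (zeroLike a)

toℕ-targetVec : ∀ q {k d} (a : Zmod q) (p : k ≤ d) →
                map toℕ (toList (targetVec q k a)) ≡ target q k a (oneIn (firstCoordinates p))
toℕ-targetVec q a (z≤n {zero})  = refl
toℕ-targetVec q a (z≤n {suc _}) = refl
toℕ-targetVec q {suc k} a (s≤s p) = cong (toℕ a ∷_) (begin
  map toℕ (toList (Vec.replicate k (zeroLike a)))  ≡⟨ cong (map toℕ) (toList-replicate k (zeroLike a)) ⟩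
  map toℕ (replicate k (zeroLike a))               ≡⟨ map-replicate toℕ k (zeroLike a) ⟩
  replicate k (toℕ (zeroLike a))                   ≡⟨ cong (replicate k) (toℕ-fromℕ< _) ⟩
  replicate k 0                                    ∎)
  where open ≡-Reasoning

mainTheorem8 : (k q : ℕ) (a : Zmod q) (d : ℕ) (Ξ : List (Vec (Zmod q) d)) →
    IsBlurer k q a d Ξ → length Ξ % 2 ≡ 1
mainTheorem8 k q a d Ξ (k≤d , _ , _ , counts) = begin
  length Ξ % 2                                   ≡⟨ length%2≡fibreSize%2 t Ξ otherFibresEven ⟩
  fibreSize t Ξ % 2                              ≡⟨ cong (λ v → fibreSize v Ξ % 2) (sym (toℕ-targetVec q a k≤d)) ⟩
  count# q Ξ N (targetVec q k a)                 ≡⟨ proj₁ (counts N ∣N∣≡k (targetVec q k a)) (toℕ-targetVec q a k≤d) ⟩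
  1                                              ∎
  where
  open ≡-Reasoning
  N : Subset d
  N = firstCoordinates k≤d
  ∣N∣≡k : ∣ N ∣ ≡ k
  ∣N∣≡k = ∣firstCoordinates∣ k≤d
  t : List ℕ
  t = target q k a (oneIn N)
  open FibreParity (≡-dec _≟ℕ_) (restrict q N)
  toℕ-restriction : ∀ c → map toℕ (toList (cast ∣N∣≡k (restrictVec q N c))) ≡ restrict q N c
  toℕ-restriction c = trans (cong (map toℕ) (toList-cast ∣N∣≡k (restrictVec q N c))) (toℕ-restrictVec q N c)
  otherFibresEven : ∀ c → c ∈ Ξ → ¬ restrict q N c ≡ t → fibreSize (restrict q N c) Ξ % 2 ≡ 0
  otherFibresEven c _ c≢t = trans (cong (λ v → fibreSize v Ξ % 2) (sym (toℕ-restriction c)))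
    (proj₂ (counts N ∣N∣≡k (cast ∣N∣≡k (restrictVec q N c))) (λ e → c≢t (trans (sym (toℕ-restriction c)) e)))
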